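{- Let $b\ge2$ and $1\le k\le b-1$. If $\sigma$ is a uniformly random permutation of $[b]$ among those consisting of a single $b$-cycle, then the probability that $L(\sigma)\ge k$ is $1/k!$.
   Context: For a permutation $\sigma$ of $[b]$, $L(\sigma)$ is the largest $\ell$ such that $\sigma(b-\ell+1)<\cdots<\sigma(b-1)<\sigma(b)$. -}

module Defs where

open import Data.Bool using (Bool; true; false; _∧_; if_then_else_)
open import Data.Nat using (ℕ; zero; suc; _<ᵇ_)
open import Data.Fin using (Fin; zero; suc; toℕ; _≟_)
open import Data.List using (List; []; _∷_; [_]; map; concatMap; allFin; upTo; reverse; length; filterᵇ)
open import Relation.Nullary using (does)
open import Data.Bool.ListAction using (all; any)

allFuns : (n m : ℕ) → List (Fin n → Fin m)
allFuns zero    m = [ (λ ()) ]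
allFuns (suc n) m =
  concatMap (λ f → map (λ x → extend x f) (allFin m)) (allFuns n m)
  where
  extend : Fin m → (Fin n → Fin m) → Fin (suc n) → Fin m
  extend x f zero    = x
  extend x f (suc i) = f i

isPerm : {b : ℕ} → (Fin b → Fin b) → Bool
isPerm {b} σ = all (λ i → all (λ j → if does (σ i ≟ σ j) then does (i ≟ j) else true)
                              (allFin b)) (allFin b)

iter : {b : ℕ} → (Fin b → Fin b) → ℕ → Fin b → Fin b
iter σ zero    i = i
iter σ (suc t) i = σ (iter σ t i)

isFullCycle : {b : ℕ} → (Fin b → Fin b) → Bool
isFullCycle {b} σ = all (λ i → all (λ j → any (λ t → does (iter σ t i ≟ j)) (upTo b))
                                   (allFin b)) (allFin b)

decPrefixLen : List ℕ → ℕ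
decPrefixLen []          = 0
decPrefixLen (x ∷ [])    = 1
decPrefixLen (x ∷ y ∷ r) = if y <ᵇ x then suc (decPrefixLen (y ∷ r)) else 1

-- L(σ): largest ℓ with σ(b-ℓ+1) < ... < σ(b)
-- (longest strictly increasing suffix of the word σ(1)…σ(b)).
L : {b : ℕ} → (Fin b → Fin b) → ℕ
L {b} σ = decPrefixLen (reverse (map (λ i → toℕ (σ i)) (allFin b)))

fullCycles : (b : ℕ) → List (Fin b → Fin b)
fullCycles b = filterᵇ (λ σ → isPerm σ ∧ isFullCycle σ) (allFuns b b)

module Submission where

-- Write C b k for the number of b-cycles with L ≥ k.  Every cycle on n + 2
-- points arises exactly once by inserting a new smallest point 0 right after
-- some q into a cycle σ on n + 1 points (Insertion, CycleCounting).  The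
-- insertion raises all old values by one and writes 0 at the position of q,
-- so reading the values from the right it places a new minimum into the list
-- whose longest decreasing prefix is L.  For k + 1 ≤ n + 1, the event L ≥ k + 1
-- survives for the n - k placements beyond the last k + 1 positions (if it held
-- for σ), is created by the one placement at the (k + 1)-st position from the
-- right (if L σ ≥ k), and fails otherwise (Descents).  Summing over all σ gives
--   C (n + 2) (k + 1) = (n - k) · C (n + 1) (k + 1) + C (n + 1) k,
--   C (n + 2) 0       = (n + 1) · C (n + 1) 0,
-- and induction on n yields k! · C (n + 1) k = C (n + 1) 0 for k ≤ n (LastRun).

open import Defs
open import Data.Nat using (ℕ; suc; _≤_; _*_; _∸_; _≤ᵇ_; _!; s≤s)
open import Data.Nat.Properties using (*-identityʳ)
open import Data.List using (length; filterᵇ)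
open import Relation.Binary.PropositionalEquality using (_≡_; cong; module ≡-Reasoning)

module FiniteSums where

  open import Data.Bool using (Bool; true; false; _∧_)
  open import Data.Nat using (ℕ; _+_; _*_)
  open import Data.Nat.Properties using (+-identityʳ; *-identityʳ; *-zeroʳ; *-comm; *-distribˡ-+; +-commutativeSemigroup)
  open import Algebra.Properties.CommutativeSemigroup +-commutativeSemigroup using (interchange)
  open import Data.Nat.ListAction using (sum)
  open import Data.Nat.ListAction.Properties using (sum-++; sum-↭)
  open import Data.List using (List; []; _∷_; map; concatMap; _++_; length; filterᵇ; reverse; cartesianProduct)
  open import Data.List.Properties using (map-cong; map-cong-local; map-++; map-∘)
  open import Data.List.Relation.Unary.All using (All)
  open import Data.List.Relation.Binary.Permutation.Propositional.Properties using (↭-reverse; map⁺)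
  open import Data.Product using (_×_; _,_)
  open import Function using (_∘_)
  open import Relation.Binary.PropositionalEquality

  private variable A B : Set

  ∑ : List A → (A → ℕ) → ℕ
  ∑ xs f = sum (map f xs)

  syntax ∑ xs (λ x → e) = ∑[ x ← xs ] e

  ⟦_⟧ : Bool → ℕ
  ⟦ true ⟧  = 1
  ⟦ false ⟧ = 0

  ⟦∧⟧ : ∀ a b → ⟦ a ∧ b ⟧ ≡ ⟦ a ⟧ * ⟦ b ⟧
  ⟦∧⟧ true  true  = refl
  ⟦∧⟧ true  false = refl
  ⟦∧⟧ false b     = refl

  ∑-cong : (xs : List A) {f g : A → ℕ} → (∀ x → f x ≡ g x) → ∑ xs f ≡ ∑ xs g
  ∑-cong xs f≗g = cong sum (map-cong f≗g xs)

  ∑-cong-local : {xs : List A} {f g : A → ℕ} → All (λ x → f x ≡ g x) xs → ∑ xs f ≡ ∑ xs g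
  ∑-cong-local eqs = cong sum (map-cong-local eqs)

  ∑-zero : (xs : List A) → ∑[ x ← xs ] 0 ≡ 0
  ∑-zero []       = refl
  ∑-zero (x ∷ xs) = ∑-zero xs

  ∑-const : (xs : List A) (c : ℕ) → ∑[ x ← xs ] c ≡ length xs * c
  ∑-const []       c = refl
  ∑-const (x ∷ xs) c = cong (c +_) (∑-const xs c)

  ∑-+ : (xs : List A) (f g : A → ℕ) → ∑[ x ← xs ] (f x + g x) ≡ ∑ xs f + ∑ xs g
  ∑-+ []       f g = refl
  ∑-+ (x ∷ xs) f g = trans (cong (f x + g x +_) (∑-+ xs f g)) (interchange (f x) (g x) (∑ xs f) (∑ xs g))

  ∑-*ˡ : (xs : List A) (c : ℕ) (f : A → ℕ) → ∑[ x ← xs ] (c * f x) ≡ c * ∑ xs f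
  ∑-*ˡ []       c f = sym (*-zeroʳ c)
  ∑-*ˡ (x ∷ xs) c f = trans (cong (c * f x +_) (∑-*ˡ xs c f)) (sym (*-distribˡ-+ c (f x) (∑ xs f)))

  ∑-*ʳ : (xs : List A) (f : A → ℕ) (c : ℕ) → ∑[ x ← xs ] (f x * c) ≡ ∑ xs f * c
  ∑-*ʳ xs f c = trans (∑-cong xs (λ x → *-comm (f x) c)) (trans (∑-*ˡ xs c f) (*-comm c (∑ xs f)))

  ∑-++ : (xs ys : List A) (f : A → ℕ) → ∑ (xs ++ ys) f ≡ ∑ xs f + ∑ ys f
  ∑-++ xs ys f = trans (cong sum (map-++ f xs ys)) (sum-++ (map f xs) (map f ys))

  ∑-map : (g : A → B) (xs : List A) (f : B → ℕ) → ∑ (map g xs) f ≡ ∑ xs (f ∘ g)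
  ∑-map g xs f = cong sum (sym (map-∘ xs))

  ∑-concatMap : (g : A → List B) (xs : List A) (f : B → ℕ) → ∑ (concatMap g xs) f ≡ ∑[ x ← xs ] ∑ (g x) f
  ∑-concatMap g []       f = refl
  ∑-concatMap g (x ∷ xs) f = trans (∑-++ (g x) (concatMap g xs) f) (cong (∑ (g x) f +_) (∑-concatMap g xs f))

  ∑-cartesianProduct : (xs : List A) (ys : List B) (f : A × B → ℕ) →
    ∑ (cartesianProduct xs ys) f ≡ ∑[ x ← xs ] ∑[ y ← ys ] f (x , y)
  ∑-cartesianProduct []       ys f = refl
  ∑-cartesianProduct (x ∷ xs) ys f =
    trans (∑-++ (map (x ,_) ys) _ f) (cong₂ _+_ (∑-map (x ,_) ys f) (∑-cartesianProduct xs ys f))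

  ∑-reverse : (xs : List A) (f : A → ℕ) → ∑ (reverse xs) f ≡ ∑ xs f
  ∑-reverse xs f = sum-↭ (map⁺ f (↭-reverse xs))

  ∑-swap : (xs : List A) (ys : List B) (f : A → B → ℕ) →
    ∑[ x ← xs ] ∑[ y ← ys ] f x y ≡ ∑[ y ← ys ] ∑[ x ← xs ] f x y
  ∑-swap []       ys f = sym (∑-zero ys)
  ∑-swap (x ∷ xs) ys f =
    trans (cong (∑ ys (f x) +_) (∑-swap xs ys f)) (sym (∑-+ ys (f x) (λ y → ∑[ x ← xs ] f x y)))

  ∑-filterᵇ : (p : A → Bool) (xs : List A) (f : A → ℕ) →
    ∑ (filterᵇ p xs) f ≡ ∑[ x ← xs ] (⟦ p x ⟧ * f x)
  ∑-filterᵇ p []       f = refl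
  ∑-filterᵇ p (x ∷ xs) f with p x
  ... | true  = cong₂ _+_ (sym (+-identityʳ (f x))) (∑-filterᵇ p xs f)
  ... | false = ∑-filterᵇ p xs f

  length-filterᵇ : (p : A → Bool) (xs : List A) → length (filterᵇ p xs) ≡ ∑[ x ← xs ] ⟦ p x ⟧
  length-filterᵇ p xs = begin
    length (filterᵇ p xs)       ≡⟨ *-identityʳ _ ⟨
    length (filterᵇ p xs) * 1   ≡⟨ ∑-const (filterᵇ p xs) 1 ⟨
    ∑ (filterᵇ p xs) (λ _ → 1)  ≡⟨ ∑-filterᵇ p xs (λ _ → 1) ⟩
    ∑[ x ← xs ] (⟦ p x ⟧ * 1)   ≡⟨ ∑-cong xs (λ x → *-identityʳ ⟦ p x ⟧) ⟩
    ∑[ x ← xs ] ⟦ p x ⟧         ∎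
    where open ≡-Reasoning

  -- Let δ be a "Kronecker delta" on B: summing δ b y * φ y over
  -- ys selects φ b.  If the points F x (x ∈ xs) meet each y with total δ-weight
  -- w y, then Σ_y w y * φ y = Σ_x φ (F x).
  double-count : (xs : List A) (ys : List B) (F : A → B) (δ : B → B → ℕ) (w φ : B → ℕ) →
    (∀ y → ∑[ x ← xs ] δ (F x) y ≡ w y) →
    (∀ b → ∑[ y ← ys ] (δ b y * φ y) ≡ φ b) →
    ∑[ y ← ys ] (w y * φ y) ≡ ∑[ x ← xs ] φ (F x)
  double-count xs ys F δ w φ weight select = begin
    ∑[ y ← ys ] (w y * φ y)
      ≡⟨ ∑-cong ys (λ y → cong (_* φ y) (weight y)) ⟨
    ∑[ y ← ys ] (∑[ x ← xs ] δ (F x) y * φ y)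
      ≡⟨ ∑-cong ys (λ y → ∑-*ʳ xs (λ x → δ (F x) y) (φ y)) ⟨
    ∑[ y ← ys ] ∑[ x ← xs ] (δ (F x) y * φ y)
      ≡⟨ ∑-swap xs ys (λ x y → δ (F x) y * φ y) ⟨
    ∑[ x ← xs ] ∑[ y ← ys ] (δ (F x) y * φ y)
      ≡⟨ ∑-cong xs (λ x → select (F x)) ⟩
    ∑[ x ← xs ] φ (F x) ∎
    where open ≡-Reasoning

module Descents where

  open FiniteSums
  open import Data.Bool using (Bool; true; false; _∧_; if_then_else_)
  open import Data.Bool.Properties using (∧-zeroʳ)
  open import Data.Nat using (ℕ; zero; suc; _+_; _*_; _∸_; _≤_; _<_; _≤ᵇ_; _<ᵇ_; z≤n; s≤s)
  open import Data.Nat.Properties using (*-zeroʳ; +-assoc; +-comm; +-identityʳ; +-suc; m≤m+n; m+[n∸m]≡n)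
  open import Data.Fin using (Fin; _≟_)
  open import Data.List using (List; []; _∷_; map; _++_; length)
  open import Data.List.Properties using (map-cong-local; map-∘)
  import Data.List.Relation.Unary.All as All
  open import Data.List.Relation.Unary.AllPairs using (_∷_)
  open import Data.List.Relation.Unary.Unique.Propositional using (Unique)
  open import Function using (_∘_)
  open import Relation.Nullary using (does)
  open import Relation.Nullary.Decidable using (dec-true; dec-false)
  open import Relation.Binary.PropositionalEquality

  decreasing : ℕ → List ℕ → Bool
  decreasing zero          _           = true
  decreasing (suc zero)    []          = false
  decreasing (suc zero)    (x ∷ _)     = true
  decreasing (suc (suc k)) []          = false
  decreasing (suc (suc k)) (x ∷ [])    = false
  decreasing (suc (suc k)) (x ∷ y ∷ r) = (y <ᵇ x) ∧ decreasing (suc k) (y ∷ r)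

  decreasing-decPrefixLen : ∀ k xs → (k ≤ᵇ decPrefixLen xs) ≡ decreasing k xs
  decreasing-decPrefixLen zero          xs          = refl
  decreasing-decPrefixLen (suc zero)    []          = refl
  decreasing-decPrefixLen (suc (suc k)) []          = refl
  decreasing-decPrefixLen (suc zero)    (x ∷ [])    = refl
  decreasing-decPrefixLen (suc (suc k)) (x ∷ [])    = refl
  decreasing-decPrefixLen (suc zero)    (x ∷ y ∷ r) = one-step (y <ᵇ x)
    where
    one-step : ∀ b → (1 ≤ᵇ (if b then suc (decPrefixLen (y ∷ r)) else 1)) ≡ true
    one-step true  = refl
    one-step false = refl
  decreasing-decPrefixLen (suc (suc k)) (x ∷ y ∷ r) =
    trans (step (y <ᵇ x)) (cong ((y <ᵇ x) ∧_) (decreasing-decPrefixLen (suc k) (y ∷ r)))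
    where
    step : ∀ b → (suc (suc k) ≤ᵇ (if b then suc (decPrefixLen (y ∷ r)) else 1))
               ≡ b ∧ (suc k ≤ᵇ decPrefixLen (y ∷ r))
    step true  = refl
    step false = refl

  decreasing-++ : ∀ k xs ys → k ≤ length xs → decreasing k (xs ++ ys) ≡ decreasing k xs
  decreasing-++ zero          xs          ys _          = refl
  decreasing-++ (suc zero)    (x ∷ xs)    ys _          = refl
  decreasing-++ (suc (suc k)) (x ∷ y ∷ r) ys (s≤s k≤)   =
    cong ((y <ᵇ x) ∧_) (decreasing-++ (suc k) (y ∷ r) ys k≤)

  withMinAt : ℕ → List ℕ → List ℕ
  withMinAt j       []       = []
  withMinAt zero    (z ∷ zs) = 0 ∷ map suc zs
  withMinAt (suc j) (z ∷ zs) = suc z ∷ withMinAt j zs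

  decreasing-withMinAt-far : ∀ k j zs → k ≤ j → decreasing k (withMinAt j zs) ≡ decreasing k zs
  decreasing-withMinAt-far zero          j             zs          _       = refl
  decreasing-withMinAt-far (suc k)       j             []          _       = refl
  decreasing-withMinAt-far (suc zero)    (suc j)       (z ∷ zs)    _       = refl
  decreasing-withMinAt-far (suc (suc k)) (suc j)       (z ∷ [])    _       = refl
  decreasing-withMinAt-far (suc (suc k)) (suc (suc j)) (z ∷ y ∷ r) (s≤s k<j) =
    cong ((y <ᵇ z) ∧_) (decreasing-withMinAt-far (suc k) (suc j) (y ∷ r) k<j)

  decreasing-withMinAt-at : ∀ k zs → k < length zs → decreasing (suc k) (withMinAt k zs) ≡ decreasing k zs
  decreasing-withMinAt-at zero          (z ∷ zs)    _          = refl
  decreasing-withMinAt-at (suc zero)    (z ∷ [])    (s≤s ())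
  decreasing-withMinAt-at (suc zero)    (z ∷ y ∷ r) _          = refl
  decreasing-withMinAt-at (suc (suc k)) (z ∷ y ∷ r) (s≤s k<)   =
    cong ((y <ᵇ z) ∧_) (decreasing-withMinAt-at (suc k) (y ∷ r) k<)

  decreasing-cons-false : ∀ k x xs → decreasing (suc k) xs ≡ false → decreasing (suc (suc k)) (x ∷ xs) ≡ false
  decreasing-cons-false k x []      _    = refl
  decreasing-cons-false k x (y ∷ r) fails = trans (cong ((y <ᵇ x) ∧_) fails) (∧-zeroʳ (y <ᵇ x))

  -- A minimum at an index j < k is followed by a larger entry within the first
  -- k + 1 entries, so the descent fails.
  decreasing-withMinAt-near : ∀ k j zs → j < k → decreasing (suc k) (withMinAt j zs) ≡ false
  decreasing-withMinAt-near (suc k) zero    []           _       = refl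
  decreasing-withMinAt-near (suc k) zero    (z ∷ [])     _       = refl
  decreasing-withMinAt-near (suc k) zero    (z ∷ y ∷ r)  _       = refl
  decreasing-withMinAt-near (suc k) (suc j) []           _       = refl
  decreasing-withMinAt-near (suc k) (suc j) (z ∷ zs)    (s≤s j<k) =
    decreasing-cons-false k (suc z) (withMinAt j zs) (decreasing-withMinAt-near k j zs j<k)

  ∑< : ℕ → (ℕ → ℕ) → ℕ
  ∑< zero    g = 0
  ∑< (suc n) g = g 0 + ∑< n (g ∘ suc)

  ∑<-split : ∀ a b (g : ℕ → ℕ) → ∑< (a + b) g ≡ ∑< a g + ∑< b (λ i → g (a + i))
  ∑<-split zero    b g = refl
  ∑<-split (suc a) b g = trans (cong (g 0 +_) (∑<-split a b (g ∘ suc))) (sym (+-assoc (g 0) _ _))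

  ∑<-cong : ∀ n {g h : ℕ → ℕ} → (∀ i → i < n → g i ≡ h i) → ∑< n g ≡ ∑< n h
  ∑<-cong zero    _   = refl
  ∑<-cong (suc n) g≡h = cong₂ _+_ (g≡h 0 (s≤s z≤n)) (∑<-cong n (λ i i<n → g≡h (suc i) (s≤s i<n)))

  ∑<-const : ∀ n c → ∑< n (λ _ → c) ≡ n * c
  ∑<-const zero    c = refl
  ∑<-const (suc n) c = cong (c +_) (∑<-const n c)

  -- Put the new minimum at each of the m positions of a list zs of length m ≥ k + 1
  -- in turn.  The first k + 1 entries then decrease: at the m - (k + 1) positions
  -- beyond them iff they did so in zs, at position k iff the first k entries of zs
  -- decrease, and never at a position below k.
  ∑-withMinAt : ∀ k zs → suc k ≤ length zs →
    ∑< (length zs) (λ j → ⟦ decreasing (suc k) (withMinAt j zs) ⟧)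
      ≡ (length zs ∸ suc k) * ⟦ decreasing (suc k) zs ⟧ + ⟦ decreasing k zs ⟧
  ∑-withMinAt k zs k<length = begin
    ∑< (length zs) g
      ≡⟨ cong (λ m → ∑< m g) length≡ ⟩
    ∑< (k + suc r) g
      ≡⟨ ∑<-split k (suc r) g ⟩
    ∑< k g + (g (k + 0) + ∑< r (λ i → g (k + suc i)))
      ≡⟨ cong₂ _+_ below (cong₂ _+_ at beyond) ⟩
    0 + (⟦ decreasing k zs ⟧ + ∑< r (λ _ → ⟦ decreasing (suc k) zs ⟧))
      ≡⟨ +-comm ⟦ decreasing k zs ⟧ _ ⟩
    ∑< r (λ _ → ⟦ decreasing (suc k) zs ⟧) + ⟦ decreasing k zs ⟧
      ≡⟨ cong (_+ ⟦ decreasing k zs ⟧) (∑<-const r _) ⟩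
    r * ⟦ decreasing (suc k) zs ⟧ + ⟦ decreasing k zs ⟧ ∎
    where
    open ≡-Reasoning
    g : ℕ → ℕ
    g j = ⟦ decreasing (suc k) (withMinAt j zs) ⟧
    r = length zs ∸ suc k
    length≡ : length zs ≡ k + suc r
    length≡ = sym (trans (+-suc k r) (m+[n∸m]≡n k<length))
    below : ∑< k g ≡ 0
    below = trans (∑<-cong k (λ j j<k → cong ⟦_⟧ (decreasing-withMinAt-near k j zs j<k)))
                  (trans (∑<-const k 0) (*-zeroʳ k))
    at : g (k + 0) ≡ ⟦ decreasing k zs ⟧
    at = cong ⟦_⟧ (trans (cong (λ j → decreasing (suc k) (withMinAt j zs)) (+-identityʳ k))
                         (decreasing-withMinAt-at k zs k<length))
    beyond : ∑< r (λ i → g (k + suc i)) ≡ ∑< r (λ _ → ⟦ decreasing (suc k) zs ⟧)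
    beyond = ∑<-cong r (λ i _ → cong ⟦_⟧ (decreasing-withMinAt-far (suc k) (k + suc i) zs
                                            (subst (suc k ≤_) (sym (+-suc k i)) (s≤s (m≤m+n k i)))))

  markMin : ∀ {n} → (Fin n → ℕ) → Fin n → Fin n → ℕ
  markMin v q i = if does (i ≟ q) then 0 else suc (v i)

  markMin-≢ : ∀ {n} (v : Fin n → ℕ) {q i} → i ≢ q → markMin v q i ≡ suc (v i)
  markMin-≢ v {q} {i} i≢q rewrite dec-false (i ≟ q) i≢q = refl

  ∑-markMin : ∀ {n} (G : List ℕ → ℕ) (v : Fin n → ℕ) (ps : List (Fin n)) → Unique ps →
    ∑[ q ← ps ] G (map (markMin v q) ps) ≡ ∑< (length ps) (λ j → G (withMinAt j (map v ps)))
  ∑-markMin G v []       _             = refl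
  ∑-markMin G v (p ∷ ps) (p∉ps ∷ ps!) = cong₂ _+_ (cong G first) rest
    where
    first : map (markMin v p) (p ∷ ps) ≡ 0 ∷ map suc (map v ps)
    first rewrite dec-true (p ≟ p) refl =
      cong (0 ∷_) (trans (map-cong-local (All.map (λ p≢q → markMin-≢ v (p≢q ∘ sym)) p∉ps)) (map-∘ ps))
    rest : ∑[ q ← ps ] G (map (markMin v q) (p ∷ ps))
           ≡ ∑< (length ps) (λ j → G (suc (v p) ∷ withMinAt j (map v ps)))
    rest = trans (∑-cong-local (All.map head-raised p∉ps)) (∑-markMin (G ∘ (suc (v p) ∷_)) v ps ps!)
      where
      head-raised : ∀ {q} → p ≢ q → G (map (markMin v q) (p ∷ ps)) ≡ G (suc (v p) ∷ map (markMin v q) ps)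
      head-raised {q} p≢q = cong (λ x → G (x ∷ map (markMin v q) ps)) (markMin-≢ v p≢q)

module MapCounting where

  open FiniteSums
  open import Data.Bool using (Bool; _∧_)
  open import Data.Nat using (ℕ; zero; suc; _+_; _*_)
  open import Data.Nat.ListAction using (sum)
  open import Data.Nat.Properties using (*-identityˡ; *-comm)
  open import Data.Fin using (Fin; zero; suc; _≟_)
  open import Data.List using (length; _∷_; map; allFin; filterᵇ)
  open import Data.List.Properties using (map-tabulate; length-tabulate)
  open import Data.Product using (_,_)
  open import Function using (_∘_; id; mk⇔)
  open import Relation.Nullary using (Dec; yes; no; does)
  open import Relation.Nullary.Decidable using (map′; _×-dec_; does-⇔)
  open import Relation.Binary.PropositionalEquality

  map-allFin-suc : ∀ {n} {A : Set} (f : Fin (suc n) → A) →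
    map f (allFin (suc n)) ≡ f zero ∷ map (f ∘ suc) (allFin n)
  map-allFin-suc f = cong (f zero ∷_) (trans (map-tabulate suc f) (sym (map-tabulate id (f ∘ suc))))

  length-allFin : ∀ n → length (allFin n) ≡ n
  length-allFin n = length-tabulate id

  ∑-allFin-suc : ∀ {n} (f : Fin (suc n) → ℕ) → ∑ (allFin (suc n)) f ≡ f zero + ∑ (allFin n) (f ∘ suc)
  ∑-allFin-suc f = cong sum (map-allFin-suc f)

  ∑-δ : ∀ {n} (y : Fin n) → ∑[ x ← allFin n ] ⟦ does (x ≟ y) ⟧ ≡ 1
  ∑-δ {suc n} zero    = trans (∑-allFin-suc {n} (λ x → ⟦ does (x ≟ zero) ⟧)) (cong suc (∑-zero (allFin n)))
  ∑-δ {suc n} (suc y) = trans (∑-allFin-suc {n} (λ x → ⟦ does (x ≟ suc y) ⟧)) (∑-δ y)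

  _≟ᶠ_ : ∀ {m m'} (f g : Fin m → Fin m') → Dec (f ≗ g)
  _≟ᶠ_ {zero}  f g = yes λ ()
  _≟ᶠ_ {suc m} f g = map′ (λ (e₀ , eₛ) → λ { zero → e₀ ; (suc i) → eₛ i }) (λ e → e zero , e ∘ suc)
                          (f zero ≟ g zero ×-dec (f ∘ suc) ≟ᶠ (g ∘ suc))

  ≟ᶠ-sym : ∀ {m m'} (f g : Fin m → Fin m') → does (f ≟ᶠ g) ≡ does (g ≟ᶠ f)
  ≟ᶠ-sym f g = does-⇔ (mk⇔ swap swap) (f ≟ᶠ g) (g ≟ᶠ f)
    where
    swap : ∀ {h k : Fin _ → Fin _} → h ≗ k → k ≗ h
    swap h≗k x = sym (h≗k x)

  -- allFuns m m' lists every map Fin m → Fin m' exactly once (up to ≗): the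
  -- list allFuns (suc m) m' consists of the extensions of each g in allFuns m m'
  -- by each value x at zero, and such an extension agrees with f iff x ≡ f zero
  -- and g ≗ f ∘ suc.
  allFuns-unique : ∀ m m' (f : Fin m → Fin m') → ∑[ g ← allFuns m m' ] ⟦ does (g ≟ᶠ f) ⟧ ≡ 1
  allFuns-unique zero    m' f = refl
  allFuns-unique (suc m) m' f = begin
    ∑[ g ← allFuns (suc m) m' ] ⟦ does (g ≟ᶠ f) ⟧
      ≡⟨ ∑-concatMap _ (allFuns m m') _ ⟩
    ∑[ g ← allFuns m m' ] ∑ (map _ (allFin m')) (λ h → ⟦ does (h ≟ᶠ f) ⟧)
      ≡⟨ ∑-cong (allFuns m m') (λ g → ∑-map _ (allFin m') _) ⟩
    ∑[ g ← allFuns m m' ] ∑[ x ← allFin m' ] ⟦ does (x ≟ f zero) ∧ does (g ≟ᶠ (f ∘ suc)) ⟧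
      ≡⟨ ∑-cong (allFuns m m') (λ g → ∑-cong (allFin m') (λ x → ⟦∧⟧ (does (x ≟ f zero)) _)) ⟩
    ∑[ g ← allFuns m m' ] ∑[ x ← allFin m' ] (⟦ does (x ≟ f zero) ⟧ * ⟦ does (g ≟ᶠ (f ∘ suc)) ⟧)
      ≡⟨ ∑-cong (allFuns m m') (λ g → ∑-*ʳ (allFin m') _ _) ⟩
    ∑[ g ← allFuns m m' ] (∑[ x ← allFin m' ] ⟦ does (x ≟ f zero) ⟧ * ⟦ does (g ≟ᶠ (f ∘ suc)) ⟧)
      ≡⟨ ∑-cong (allFuns m m') (λ g → trans (cong (_* ⟦ does (g ≟ᶠ (f ∘ suc)) ⟧) (∑-δ (f zero)))
                                            (*-identityˡ _)) ⟩
    ∑[ g ← allFuns m m' ] ⟦ does (g ≟ᶠ (f ∘ suc)) ⟧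
      ≡⟨ allFuns-unique m m' (f ∘ suc) ⟩
    1 ∎
    where open ≡-Reasoning

  Extensional : ∀ {m m'} → ((Fin m → Fin m') → ℕ) → Set
  Extensional φ = ∀ {f g} → f ≗ g → φ f ≡ φ g

  ∑-allFuns-select : ∀ m m' (φ : (Fin m → Fin m') → ℕ) → Extensional φ → ∀ f →
    ∑[ g ← allFuns m m' ] (⟦ does (f ≟ᶠ g) ⟧ * φ g) ≡ φ f
  ∑-allFuns-select m m' φ φ-ext f = begin
    ∑[ g ← allFuns m m' ] (⟦ does (f ≟ᶠ g) ⟧ * φ g)   ≡⟨ ∑-cong (allFuns m m') delta-swap ⟩
    ∑[ g ← allFuns m m' ] (⟦ does (g ≟ᶠ f) ⟧ * φ f)   ≡⟨ ∑-*ʳ (allFuns m m') _ (φ f) ⟩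
    ∑[ g ← allFuns m m' ] ⟦ does (g ≟ᶠ f) ⟧ * φ f     ≡⟨ cong (_* φ f) (allFuns-unique m m' f) ⟩
    1 * φ f                                           ≡⟨ *-identityˡ (φ f) ⟩
    φ f                                               ∎
    where
    open ≡-Reasoning
    delta-swap : ∀ g → ⟦ does (f ≟ᶠ g) ⟧ * φ g ≡ ⟦ does (g ≟ᶠ f) ⟧ * φ f
    delta-swap g with f ≟ᶠ g | ≟ᶠ-sym f g
    ... | yes f≗g | eq rewrite sym eq = cong (1 *_) (sym (φ-ext f≗g))
    ... | no  _   | eq rewrite sym eq = refl

  ∑-filter-allFuns : ∀ m m' (p : (Fin m → Fin m') → Bool) → Extensional (λ σ → ⟦ p σ ⟧) → ∀ τ →
    ∑[ σ ← filterᵇ p (allFuns m m') ] ⟦ does (σ ≟ᶠ τ) ⟧ ≡ ⟦ p τ ⟧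
  ∑-filter-allFuns m m' p p-ext τ = begin
    ∑[ σ ← filterᵇ p (allFuns m m') ] ⟦ does (σ ≟ᶠ τ) ⟧
      ≡⟨ ∑-filterᵇ p (allFuns m m') _ ⟩
    ∑[ σ ← allFuns m m' ] (⟦ p σ ⟧ * ⟦ does (σ ≟ᶠ τ) ⟧)
      ≡⟨ ∑-cong (allFuns m m') (λ σ → trans (*-comm ⟦ p σ ⟧ _)
                                            (cong (λ b → ⟦ b ⟧ * ⟦ p σ ⟧) (≟ᶠ-sym σ τ))) ⟩
    ∑[ σ ← allFuns m m' ] (⟦ does (τ ≟ᶠ σ) ⟧ * ⟦ p σ ⟧)
      ≡⟨ ∑-allFuns-select m m' (λ σ → ⟦ p σ ⟧) p-ext τ ⟩
    ⟦ p τ ⟧ ∎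
    where open ≡-Reasoning

module Cycles where

  open import Data.Bool using (Bool; true; T; _∧_; if_then_else_)
  open import Data.Bool.Properties using (T-∧)
  open import Data.Bool.ListAction using (all; any)
  open import Data.Nat as ℕ using (ℕ; zero; suc; _+_; _∸_; _<_; _≤_; _<?_)
  open import Data.Nat.Properties using (≮⇒≥; ≤-trans; ≤-reflexive; <-≤-trans; +-monoʳ-<; m∸n+n≡m; n<1+n)
  open import Data.Nat.Induction using (<-rec)
  open import Data.Fin using (Fin; toℕ; _≟_)
  open import Data.Fin.Properties using (pigeonhole; toℕ<n)
  open import Data.List using (allFin; upTo)
  import Data.List.Relation.Unary.All as All
  open import Data.List.Relation.Unary.All.Properties using (all⁺; all⁻)
  open import Data.List.Relation.Unary.Any using (satisfied)
  open import Data.List.Relation.Unary.Any.Properties using (any⁺; any⁻)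
  open import Data.List.Membership.Propositional using (lose)
  open import Data.List.Membership.Propositional.Properties using (∈-allFin; ∈-upTo⁺)
  open import Data.Product using (∃-syntax; _×_; _,_)
  open import Function using (Equivalence)
  open import Function.Definitions using (Injective)
  open import Relation.Nullary using (Dec; yes; no; does)
  open import Relation.Binary.PropositionalEquality
  open import Data.Empty using (⊥-elim)

  private variable
    m : ℕ
    P Q : Set

  Reach : (Fin m → Fin m) → Fin m → Fin m → Set
  Reach σ i j = ∃[ t ] iter σ t i ≡ j

  IsCycle : (Fin m → Fin m) → Set
  IsCycle σ = Injective _≡_ _≡_ σ × (∀ i j → Reach σ i j)

  iter-+ : (σ : Fin m → Fin m) (s t : ℕ) (i : Fin m) → iter σ (s + t) i ≡ iter σ s (iter σ t i)
  iter-+ σ zero    t i = refl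
  iter-+ σ (suc s) t i = cong σ (iter-+ σ s t i)

  iter-cong : {σ τ : Fin m → Fin m} → σ ≗ τ → ∀ t → iter σ t ≗ iter τ t
  iter-cong σ≗τ zero    i = refl
  iter-cong {σ = σ} σ≗τ (suc t) i = trans (cong σ (iter-cong σ≗τ t i)) (σ≗τ _)

  Reach-trans : {σ : Fin m → Fin m} {i j k : Fin m} → Reach σ i j → Reach σ j k → Reach σ i k
  Reach-trans {σ = σ} {i} (s , iₛ≡j) (t , jₜ≡k) =
    t + s , trans (iter-+ σ t s i) (trans (cong (iter σ t) iₛ≡j) jₜ≡k)

  IsCycle-resp-≗ : {σ τ : Fin m → Fin m} → σ ≗ τ → IsCycle σ → IsCycle τ
  IsCycle-resp-≗ σ≗τ (inj , orbit) =
    (λ {i} {j} e → inj (trans (σ≗τ i) (trans e (sym (σ≗τ j))))) ,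
    (λ i j → let (t , e) = orbit i j in t , trans (sym (iter-cong σ≗τ t i)) e)

  orbit-shortcut : (σ : Fin m → Fin m) (i : Fin m) (t : ℕ) → m ≤ t →
    ∃[ s ] s < t × iter σ s i ≡ iter σ t i
  orbit-shortcut {m} σ i t m≤t with pigeonhole (n<1+n m) (λ s → iter σ (toℕ s) i)
  ... | a , b , a<b , eq = (t ∸ toℕ b) + toℕ a , shorter , reaches
    where
    b≤t : toℕ b ≤ t
    b≤t = ≤-trans (ℕ.s≤s⁻¹ (toℕ<n b)) m≤t
    shorter : (t ∸ toℕ b) + toℕ a < t
    shorter = <-≤-trans (+-monoʳ-< (t ∸ toℕ b) a<b) (≤-reflexive (m∸n+n≡m b≤t))
    reaches : iter σ ((t ∸ toℕ b) + toℕ a) i ≡ iter σ t i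
    reaches = begin
      iter σ ((t ∸ toℕ b) + toℕ a) i         ≡⟨ iter-+ σ (t ∸ toℕ b) (toℕ a) i ⟩
      iter σ (t ∸ toℕ b) (iter σ (toℕ a) i)  ≡⟨ cong (iter σ (t ∸ toℕ b)) eq ⟩
      iter σ (t ∸ toℕ b) (iter σ (toℕ b) i)  ≡⟨ iter-+ σ (t ∸ toℕ b) (toℕ b) i ⟨
      iter σ ((t ∸ toℕ b) + toℕ b) i         ≡⟨ cong (λ s → iter σ s i) (m∸n+n≡m b≤t) ⟩
      iter σ t i                             ∎
      where open ≡-Reasoning

  orbit-bounded : (σ : Fin m → Fin m) (i : Fin m) (t : ℕ) → ∃[ s ] s < m × iter σ s i ≡ iter σ t i
  orbit-bounded {m} σ i = <-rec _ step
    where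
    step : ∀ t → (∀ {s} → s < t → ∃[ r ] r < m × iter σ r i ≡ iter σ s i) →
           ∃[ r ] r < m × iter σ r i ≡ iter σ t i
    step t earlier with t <? m
    ... | yes t<m = t , t<m , refl
    ... | no  t≮m =
      let (s , s<t , sₜ) = orbit-shortcut σ i t (≮⇒≥ t≮m)
          (r , r<m , rₛ) = earlier s<t
      in r , r<m , trans rₛ sₜ

  T-does⁻ : (p? : Dec P) → T (does p?) → P
  T-does⁻ (yes p) _ = p

  T-does⁺ : (p? : Dec P) → P → T (does p?)
  T-does⁺ (yes _) _ = _
  T-does⁺ (no ¬p) p = ¬p p

  T-implication⁻ : (p? : Dec P) (q? : Dec Q) → T (if does p? then does q? else true) → P → Q
  T-implication⁻ (yes _) q? t _ = T-does⁻ q? t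
  T-implication⁻ (no ¬p) q? t p = ⊥-elim (¬p p)

  T-implication⁺ : (p? : Dec P) (q? : Dec Q) → (P → Q) → T (if does p? then does q? else true)
  T-implication⁺ (yes p) q? p⇒q = T-does⁺ q? (p⇒q p)
  T-implication⁺ (no _)  q? p⇒q = _

  -- The test defining fullCycles decides IsCycle.  Completeness of isFullCycle
  -- needs orbit-bounded, as it only tries fewer than m steps.
  isCycle? : (Fin m → Fin m) → Bool
  isCycle? σ = isPerm σ ∧ isFullCycle σ

  isPerm-sound : (σ : Fin m → Fin m) → T (isPerm σ) → Injective _≡_ _≡_ σ
  isPerm-sound {m} σ t {i} {j} =
    let tests = All.lookup (all⁺ _ _ t) (∈-allFin i)
    in T-implication⁻ (σ i ≟ σ j) (i ≟ j) (All.lookup (all⁺ _ _ tests) (∈-allFin j))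

  isPerm-complete : (σ : Fin m → Fin m) → Injective _≡_ _≡_ σ → T (isPerm σ)
  isPerm-complete {m} σ inj =
    all⁻ row {xs = allFin m} (All.tabulate λ {i} _ →
    all⁻ (test i) {xs = allFin m} (All.tabulate λ {j} _ →
    T-implication⁺ (σ i ≟ σ j) (i ≟ j) inj))
    where
    test : Fin m → Fin m → Bool
    test i j = if does (σ i ≟ σ j) then does (i ≟ j) else true
    row : Fin m → Bool
    row i = all (test i) (allFin m)

  isFullCycle-sound : (σ : Fin m → Fin m) → T (isFullCycle σ) → ∀ i j → Reach σ i j
  isFullCycle-sound {m} σ t i j =
    let tests = All.lookup (all⁺ _ _ t) (∈-allFin i)
        (s , reaches) = satisfied (any⁻ _ (upTo m) (All.lookup (all⁺ _ _ tests) (∈-allFin j)))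
    in s , T-does⁻ (iter σ s i ≟ j) reaches

  isFullCycle-complete : (σ : Fin m → Fin m) → (∀ i j → Reach σ i j) → T (isFullCycle σ)
  isFullCycle-complete {m} σ orbit =
    all⁻ row {xs = allFin m} (All.tabulate λ {i} _ →
    all⁻ (test i) {xs = allFin m} (All.tabulate λ {j} _ →
    let (t , iₜ≡j) = orbit i j
        (s , s<m , iₛ≡iₜ) = orbit-bounded σ i t
    in any⁺ (hits i j) (lose (∈-upTo⁺ s<m) (T-does⁺ (iter σ s i ≟ j) (trans iₛ≡iₜ iₜ≡j)))))
    where
    hits : Fin m → Fin m → ℕ → Bool
    hits i j t = does (iter σ t i ≟ j)
    test : Fin m → Fin m → Bool
    test i j = any (hits i j) (upTo m)
    row : Fin m → Bool
    row i = all (test i) (allFin m)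

  isCycle?-sound : (σ : Fin m → Fin m) → T (isCycle? σ) → IsCycle σ
  isCycle?-sound σ t =
    let (perm , full) = Equivalence.to T-∧ t in isPerm-sound σ perm , isFullCycle-sound σ full

  isCycle?-complete : (σ : Fin m → Fin m) → IsCycle σ → T (isCycle? σ)
  isCycle?-complete σ (inj , orbit) =
    Equivalence.from T-∧ (isPerm-complete σ inj , isFullCycle-complete σ orbit)

module Insertion where

  open Cycles
  open import Data.Bool using (if_then_else_)
  open import Data.Nat using (ℕ; zero; suc)
  open import Data.Fin using (Fin; zero; suc; _≟_)
  open import Data.Fin.Properties using (suc-injective; 0≢1+n)
  open import Data.Product using (∃-syntax; _×_; _,_)
  open import Data.Empty using (⊥-elim)
  open import Function using (_∘_)
  open import Function.Definitions using (Injective)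
  open import Relation.Nullary using (yes; no; does)
  open import Relation.Nullary.Decidable using (dec-true; dec-false)
  open import Relation.Binary.PropositionalEquality

  private variable n : ℕ

  -- Insert a new point 0 into σ right after q: the old points are shifted up by
  -- one and the cycle  … ↦ q ↦ σ q ↦ …  becomes  … ↦ suc q ↦ 0 ↦ suc (σ q) ↦ ….
  insertAfter : (Fin n → Fin n) → Fin n → Fin (suc n) → Fin (suc n)
  insertAfter σ q zero    = suc (σ q)
  insertAfter σ q (suc i) = if does (i ≟ q) then zero else suc (σ i)

  -- pre q is a bijection from Fin n onto the points other than suc q, sending i
  -- to the point that insertAfter σ q maps to suc (σ i); unshift q is its inverse.
  pre : Fin n → Fin n → Fin (suc n)
  pre q i = if does (i ≟ q) then zero else suc i

  unshift : Fin n → Fin (suc n) → Fin n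
  unshift q zero    = q
  unshift q (suc i) = i

  unshift-pre : (q i : Fin n) → unshift q (pre q i) ≡ i
  unshift-pre q i with i ≟ q
  ... | yes i≡q = sym i≡q
  ... | no  _   = refl

  pre-unshift : (q : Fin n) (x : Fin (suc n)) → x ≢ suc q → pre q (unshift q x) ≡ x
  pre-unshift q zero    _      rewrite dec-true (q ≟ q) refl = refl
  pre-unshift q (suc i) x≢sucq rewrite dec-false (i ≟ q) (x≢sucq ∘ cong suc) = refl

  suc-unshift : (q : Fin n) {y : Fin (suc n)} → y ≢ zero → suc (unshift q y) ≡ y
  suc-unshift q {zero}  y≢0 = ⊥-elim (y≢0 refl)
  suc-unshift q {suc y} _   = refl

  insertAfter-cong : {σ τ : Fin n → Fin n} (q : Fin n) → σ ≗ τ → insertAfter σ q ≗ insertAfter τ q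
  insertAfter-cong q σ≗τ zero    = cong suc (σ≗τ q)
  insertAfter-cong q σ≗τ (suc i) = cong (λ y → if does (i ≟ q) then zero else suc y) (σ≗τ i)

  module _ (σ : Fin n → Fin n) (q : Fin n) where

    insertAfter-q : insertAfter σ q (suc q) ≡ zero
    insertAfter-q rewrite dec-true (q ≟ q) refl = refl

    insertAfter-≢ : ∀ {i} → i ≢ q → insertAfter σ q (suc i) ≡ suc (σ i)
    insertAfter-≢ {i} i≢q rewrite dec-false (i ≟ q) i≢q = refl

    insertAfter-pre : ∀ i → insertAfter σ q (pre q i) ≡ suc (σ i)
    insertAfter-pre i with i ≟ q
    ... | yes refl = refl
    ... | no  i≢q  = insertAfter-≢ i≢q

    insertAfter-off : ∀ {x} → x ≢ suc q → insertAfter σ q x ≡ suc (σ (unshift q x))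
    insertAfter-off {x} x≢sucq =
      trans (cong (insertAfter σ q) (sym (pre-unshift q x x≢sucq))) (insertAfter-pre (unshift q x))

    insertAfter-injective : Injective _≡_ _≡_ σ → Injective _≡_ _≡_ (insertAfter σ q)
    insertAfter-injective inj {x} {y} e with x ≟ suc q | y ≟ suc q
    ... | yes x≡sucq | yes y≡sucq = trans x≡sucq (sym y≡sucq)
    ... | yes refl   | no  y≢sucq = ⊥-elim (0≢1+n (trans (sym insertAfter-q) (trans e (insertAfter-off y≢sucq))))
    ... | no  x≢sucq | yes refl   = ⊥-elim (0≢1+n (trans (sym insertAfter-q) (trans (sym e) (insertAfter-off x≢sucq))))
    ... | no  x≢sucq | no  y≢sucq = begin
      x                    ≡⟨ pre-unshift q x x≢sucq ⟨
      pre q (unshift q x)  ≡⟨ cong (pre q) (inj (suc-injective σ-values)) ⟩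
      pre q (unshift q y)  ≡⟨ pre-unshift q y y≢sucq ⟩
      y                    ∎
      where
      open ≡-Reasoning
      σ-values : suc (σ (unshift q x)) ≡ suc (σ (unshift q y))
      σ-values = trans (sym (insertAfter-off x≢sucq)) (trans e (insertAfter-off y≢sucq))

    insertAfter-step : ∀ i → Reach (insertAfter σ q) (suc i) (suc (σ i))
    insertAfter-step i with i ≟ q
    ... | yes refl = 2 , cong (insertAfter σ q) insertAfter-q
    ... | no  i≢q  = 1 , insertAfter-≢ i≢q

    insertAfter-lift : ∀ {i j} → Reach σ i j → Reach (insertAfter σ q) (suc i) (suc j)
    insertAfter-lift     (zero  , refl) = 0 , refl
    insertAfter-lift {i} (suc t , refl) =
      Reach-trans {σ = insertAfter σ q} (insertAfter-lift (t , refl)) (insertAfter-step (iter σ t i))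

    insertAfter-orbit : (∀ i j → Reach σ i j) → ∀ x y → Reach (insertAfter σ q) x y
    insertAfter-orbit orbit zero    zero    = 0 , refl
    insertAfter-orbit orbit zero    (suc j) =
      Reach-trans {σ = insertAfter σ q} (1 , refl) (insertAfter-lift (orbit (σ q) j))
    insertAfter-orbit orbit (suc i) zero    =
      Reach-trans {σ = insertAfter σ q} (insertAfter-lift (orbit i q)) (1 , insertAfter-q)
    insertAfter-orbit orbit (suc i) (suc j) = insertAfter-lift (orbit i j)

    insertAfter-IsCycle : IsCycle σ → IsCycle (insertAfter σ q)
    insertAfter-IsCycle (inj , orbit) = insertAfter-injective inj , insertAfter-orbit orbit

    unshift-step : ∀ y → Reach σ (unshift q y) (unshift q (insertAfter σ q y))
    unshift-step zero = 1 , refl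
    unshift-step (suc i) with i ≟ q
    ... | yes refl = 0 , refl
    ... | no  _    = 1 , refl

    unshift-orbit : ∀ t x → Reach σ (unshift q x) (unshift q (iter (insertAfter σ q) t x))
    unshift-orbit zero    x = 0 , refl
    unshift-orbit (suc t) x =
      Reach-trans {σ = σ} (unshift-orbit t x) (unshift-step (iter (insertAfter σ q) t x))

    deleteInserted-IsCycle : IsCycle (insertAfter σ q) → IsCycle σ
    deleteInserted-IsCycle (inj , orbit) = injective , σ-orbit
      where
      injective : Injective _≡_ _≡_ σ
      injective {i} {j} σi≡σj = begin
        i                    ≡⟨ unshift-pre q i ⟨
        unshift q (pre q i)  ≡⟨ cong (unshift q) (inj {pre q i} {pre q j} same-image) ⟩
        unshift q (pre q j)  ≡⟨ unshift-pre q j ⟩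
        j                    ∎
        where
        open ≡-Reasoning
        same-image : insertAfter σ q (pre q i) ≡ insertAfter σ q (pre q j)
        same-image = trans (insertAfter-pre i) (trans (cong suc σi≡σj) (sym (insertAfter-pre j)))
      σ-orbit : ∀ i j → Reach σ i j
      σ-orbit i j with orbit (pre q i) (pre q j)
      ... | t , reaches = subst₂ (Reach σ) (unshift-pre q i) (trans (cong (unshift q) reaches) (unshift-pre q j))
                                 (unshift-orbit t (pre q i))

  insertAfter-unique : {σ τ : Fin n → Fin n} {q r : Fin n} →
    insertAfter σ q ≗ insertAfter τ r → σ ≗ τ × q ≡ r
  insertAfter-unique {σ = σ} {τ} {q} {r} e with q ≟ r
  ... | no  q≢r  = ⊥-elim (0≢1+n (trans (sym (insertAfter-q σ q)) (trans (e (suc q)) (insertAfter-≢ τ r q≢r))))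
  ... | yes refl = same-values , refl
    where
    same-values : σ ≗ τ
    same-values i =
      suc-injective (trans (sym (insertAfter-pre σ q i)) (trans (e (pre q i)) (insertAfter-pre τ q i)))

  fixed-point-iter : (h : Fin n → Fin n) {x : Fin n} → h x ≡ x → ∀ t → iter h t x ≡ x
  fixed-point-iter h hx≡x zero    = refl
  fixed-point-iter h hx≡x (suc t) = trans (cong h (fixed-point-iter h hx≡x t)) hx≡x

  -- In a cycle on at least two points, zero is the image of some suc q: the
  -- orbit from suc zero reaches zero through a predecessor, which is not zero
  -- itself because a cycle on two or more points has no fixed point.
  zero-preimage : (h : Fin (suc (suc n)) → Fin (suc (suc n))) → IsCycle h → ∃[ q ] h (suc q) ≡ zero
  zero-preimage h (_ , orbit) with orbit (suc zero) zero
  ... | zero  , ()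
  ... | suc t , reaches with iter h t (suc zero)
  ... | suc q = q , reaches
  ... | zero  with orbit zero (suc zero)
  ...   | s , leaves = ⊥-elim (0≢1+n (trans (sym (fixed-point-iter h reaches s)) leaves))

  cycle-decompose : (h : Fin (suc (suc n)) → Fin (suc (suc n))) → IsCycle h →
    ∃[ σ ] ∃[ q ] IsCycle σ × h ≗ insertAfter σ q
  cycle-decompose h h-cycle@(inj , _) with zero-preimage h h-cycle
  ... | q , hq≡0 = σ , q , deleteInserted-IsCycle σ q (IsCycle-resp-≗ h≗ h-cycle) , h≗
    where
    σ : Fin _ → Fin _
    σ = unshift q ∘ h ∘ pre q
    h≗ : h ≗ insertAfter σ q
    h≗ x with x ≟ suc q
    ... | yes refl = trans hq≡0 (sym (insertAfter-q σ q))
    ... | no  x≢sucq = begin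
      h x                                    ≡⟨ suc-unshift q (λ hx≡0 → x≢sucq (inj (trans hx≡0 (sym hq≡0)))) ⟨
      suc (unshift q (h x))                  ≡⟨ cong (suc ∘ unshift q ∘ h) (pre-unshift q x x≢sucq) ⟨
      suc (σ (unshift q x))                  ≡⟨ insertAfter-off σ q x≢sucq ⟨
      insertAfter σ q x                      ∎
      where open ≡-Reasoning

module CycleCounting where

  open FiniteSums
  open MapCounting
  open Cycles
  open Insertion
  open import Data.Bool using (T; _∧_)
  open import Data.Bool.Properties using (T-≡)
  open import Data.Nat using (ℕ; suc; _*_)
  open import Data.Nat.Properties using (*-identityʳ; *-zeroʳ)
  open import Data.Fin using (Fin; _≟_)
  open import Data.List using (allFin; cartesianProduct)
  open import Data.Product using (∃-syntax; _×_; _,_; uncurry)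
  open import Function using (_∘_; mk⇔; Equivalence)
  open import Relation.Nullary using (¬_; Dec; yes; no; does)
  open import Relation.Nullary.Decidable using (_×-dec_; T?; dec-false; does-⇔)
  open import Relation.Binary.PropositionalEquality

  private variable n : ℕ

  isCycle?-cong : {σ τ : Fin n → Fin n} → σ ≗ τ → isCycle? σ ≡ isCycle? τ
  isCycle?-cong {n} {σ} {τ} σ≗τ =
    does-⇔ (mk⇔ (transport σ≗τ) (transport (sym ∘ σ≗τ))) (T? (isCycle? σ)) (T? (isCycle? τ))
    where
    transport : {f g : Fin n → Fin n} → f ≗ g → T (isCycle? f) → T (isCycle? g)
    transport {f} {g} f≗g = isCycle?-complete g ∘ IsCycle-resp-≗ f≗g ∘ isCycle?-sound f

  insertAfter-δ : (σ τ : Fin n → Fin n) (q r : Fin n) →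
    ⟦ does (insertAfter σ q ≟ᶠ insertAfter τ r) ⟧ ≡ ⟦ does (σ ≟ᶠ τ) ⟧ * ⟦ does (q ≟ r) ⟧
  insertAfter-δ σ τ q r = trans (cong ⟦_⟧ same) (⟦∧⟧ (does (σ ≟ᶠ τ)) (does (q ≟ r)))
    where
    same : does (insertAfter σ q ≟ᶠ insertAfter τ r) ≡ does (σ ≟ᶠ τ) ∧ does (q ≟ r)
    same = does-⇔ (mk⇔ insertAfter-unique from-parts)
                  (insertAfter σ q ≟ᶠ insertAfter τ r) (σ ≟ᶠ τ ×-dec q ≟ r)
      where
      from-parts : σ ≗ τ × q ≡ r → insertAfter σ q ≗ insertAfter τ r
      from-parts (σ≗τ , refl) = insertAfter-cong q σ≗τ

  insertionsOnto : (Fin (suc (suc n)) → Fin (suc (suc n))) → ℕ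
  insertionsOnto {n} h = ∑[ σ ← fullCycles (suc n) ] ∑[ q ← allFin (suc n) ] ⟦ does (insertAfter σ q ≟ᶠ h) ⟧

  insertionsOnto-cycle : (h : Fin (suc (suc n)) → Fin (suc (suc n))) → IsCycle h → insertionsOnto h ≡ 1
  insertionsOnto-cycle {n} h h-cycle = count (cycle-decompose h h-cycle)
    where
    count : ∃[ τ ] ∃[ r ] IsCycle τ × h ≗ insertAfter τ r → insertionsOnto h ≡ 1
    count (τ , r , τ-cycle , h≗) = begin
      ∑[ σ ← fullCycles (suc n) ] ∑[ q ← allFin (suc n) ] ⟦ does (insertAfter σ q ≟ᶠ h) ⟧
        ≡⟨ ∑-cong (fullCycles (suc n)) (λ σ → ∑-cong (allFin (suc n)) (factor σ)) ⟩
      ∑[ σ ← fullCycles (suc n) ] ∑[ q ← allFin (suc n) ] (⟦ does (σ ≟ᶠ τ) ⟧ * ⟦ does (q ≟ r) ⟧)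
        ≡⟨ ∑-cong (fullCycles (suc n)) sum-over-q ⟩
      ∑[ σ ← fullCycles (suc n) ] ⟦ does (σ ≟ᶠ τ) ⟧
        ≡⟨ ∑-filter-allFuns (suc n) (suc n) isCycle? (cong ⟦_⟧ ∘ isCycle?-cong) τ ⟩
      ⟦ isCycle? τ ⟧
        ≡⟨ cong ⟦_⟧ (Equivalence.to (T-≡ {isCycle? τ}) (isCycle?-complete τ τ-cycle)) ⟩
      1 ∎
      where
      open ≡-Reasoning
      factor : ∀ σ q → ⟦ does (insertAfter σ q ≟ᶠ h) ⟧ ≡ ⟦ does (σ ≟ᶠ τ) ⟧ * ⟦ does (q ≟ r) ⟧
      factor σ q = trans (cong ⟦_⟧ (does-⇔ h-is-insertion (insertAfter σ q ≟ᶠ h) (insertAfter σ q ≟ᶠ insertAfter τ r)))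
                         (insertAfter-δ σ τ q r)
        where
        h-is-insertion = mk⇔ (λ e x → trans (e x) (h≗ x)) (λ e x → trans (e x) (sym (h≗ x)))
      sum-over-q : ∀ σ → ∑[ q ← allFin (suc n) ] (⟦ does (σ ≟ᶠ τ) ⟧ * ⟦ does (q ≟ r) ⟧)
                       ≡ ⟦ does (σ ≟ᶠ τ) ⟧
      sum-over-q σ = begin
        ∑[ q ← allFin (suc n) ] (⟦ does (σ ≟ᶠ τ) ⟧ * ⟦ does (q ≟ r) ⟧)
          ≡⟨ ∑-*ˡ (allFin (suc n)) ⟦ does (σ ≟ᶠ τ) ⟧ (λ q → ⟦ does (q ≟ r) ⟧) ⟩
        ⟦ does (σ ≟ᶠ τ) ⟧ * ∑[ q ← allFin (suc n) ] ⟦ does (q ≟ r) ⟧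
          ≡⟨ cong (⟦ does (σ ≟ᶠ τ) ⟧ *_) (∑-δ r) ⟩
        ⟦ does (σ ≟ᶠ τ) ⟧ * 1
          ≡⟨ *-identityʳ _ ⟩
        ⟦ does (σ ≟ᶠ τ) ⟧ ∎

  -- Inserting into a cycle always gives a cycle, so a non-cycle is never obtained.
  insertionsOnto-noncycle : (h : Fin (suc (suc n)) → Fin (suc (suc n))) → ¬ IsCycle h → insertionsOnto h ≡ 0
  insertionsOnto-noncycle {n} h ¬h-cycle = begin
    ∑[ σ ← fullCycles (suc n) ] hits σ
      ≡⟨ ∑-filterᵇ isCycle? (allFuns (suc n) (suc n)) hits ⟩
    ∑[ σ ← allFuns (suc n) (suc n) ] (⟦ isCycle? σ ⟧ * hits σ)
      ≡⟨ ∑-cong (allFuns (suc n) (suc n)) (λ σ → vanishes σ (T? (isCycle? σ))) ⟩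
    ∑[ σ ← allFuns (suc n) (suc n) ] 0
      ≡⟨ ∑-zero (allFuns (suc n) (suc n)) ⟩
    0 ∎
    where
    open ≡-Reasoning
    hits : (Fin (suc n) → Fin (suc n)) → ℕ
    hits σ = ∑[ q ← allFin (suc n) ] ⟦ does (insertAfter σ q ≟ᶠ h) ⟧
    misses : ∀ σ → IsCycle σ → hits σ ≡ 0
    misses σ σ-cycle = trans (∑-cong (allFin (suc n)) miss) (∑-zero (allFin (suc n)))
      where
      miss : ∀ q → ⟦ does (insertAfter σ q ≟ᶠ h) ⟧ ≡ 0
      miss q = cong ⟦_⟧ (dec-false (insertAfter σ q ≟ᶠ h) λ e →
        ¬h-cycle (IsCycle-resp-≗ e (insertAfter-IsCycle σ q σ-cycle)))
    vanishes : ∀ σ → Dec (T (isCycle? σ)) → ⟦ isCycle? σ ⟧ * hits σ ≡ 0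
    vanishes σ (no ¬σ-cycle) = cong (λ b → ⟦ b ⟧ * hits σ) (dec-false (T? (isCycle? σ)) ¬σ-cycle)
    vanishes σ (yes σ-cycle) =
      trans (cong (⟦ isCycle? σ ⟧ *_) (misses σ (isCycle?-sound σ σ-cycle))) (*-zeroʳ ⟦ isCycle? σ ⟧)

  insertionsOnto-δ : (h : Fin (suc (suc n)) → Fin (suc (suc n))) → insertionsOnto h ≡ ⟦ isCycle? h ⟧
  insertionsOnto-δ h = by-cases (T? (isCycle? h))
    where
    by-cases : Dec (T (isCycle? h)) → insertionsOnto h ≡ ⟦ isCycle? h ⟧
    by-cases (yes h-cycle) = trans (insertionsOnto-cycle h (isCycle?-sound h h-cycle))
                                   (cong ⟦_⟧ (sym (Equivalence.to (T-≡ {isCycle? h}) h-cycle)))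
    by-cases (no ¬h-cycle) = trans (insertionsOnto-noncycle h (¬h-cycle ∘ isCycle?-complete h))
                                   (cong ⟦_⟧ (sym (dec-false (T? (isCycle? h)) ¬h-cycle)))

  ∑-fullCycles-suc : (φ : (Fin (suc (suc n)) → Fin (suc (suc n))) → ℕ) → Extensional φ →
    ∑ (fullCycles (suc (suc n))) φ ≡ ∑[ σ ← fullCycles (suc n) ] ∑[ q ← allFin (suc n) ] φ (insertAfter σ q)
  ∑-fullCycles-suc {n} φ φ-ext = begin
    ∑ (fullCycles (suc (suc n))) φ
      ≡⟨ ∑-filterᵇ isCycle? (allFuns (suc (suc n)) (suc (suc n))) φ ⟩
    ∑[ h ← allFuns (suc (suc n)) (suc (suc n)) ] (⟦ isCycle? h ⟧ * φ h)
      ≡⟨ double-count pairs (allFuns (suc (suc n)) (suc (suc n))) (uncurry insertAfter)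
                      (λ f g → ⟦ does (f ≟ᶠ g) ⟧) (⟦_⟧ ∘ isCycle?) φ cover
                      (∑-allFuns-select (suc (suc n)) (suc (suc n)) φ φ-ext) ⟩
    ∑ pairs (φ ∘ uncurry insertAfter)
      ≡⟨ ∑-cartesianProduct (fullCycles (suc n)) (allFin (suc n)) (φ ∘ uncurry insertAfter) ⟩
    ∑[ σ ← fullCycles (suc n) ] ∑[ q ← allFin (suc n) ] φ (insertAfter σ q) ∎
    where
    open ≡-Reasoning
    pairs = cartesianProduct (fullCycles (suc n)) (allFin (suc n))
    cover : ∀ h → ∑[ p ← pairs ] ⟦ does (uncurry insertAfter p ≟ᶠ h) ⟧ ≡ ⟦ isCycle? h ⟧
    cover h = trans (∑-cartesianProduct (fullCycles (suc n)) (allFin (suc n)) _) (insertionsOnto-δ h)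

module LastRun where

  open FiniteSums
  open MapCounting
  open Cycles
  open Insertion
  open CycleCounting
  open Descents
  open import Data.Nat using (ℕ; zero; suc; _+_; _*_; _∸_; _≤_; _≤?_; _≤ᵇ_; _!; s≤s)
  open import Data.Nat.Properties
    using (*-distribˡ-+; *-distribʳ-+; *-assoc; +-suc; +-identityʳ; m∸n+n≡m; ≤-antisym; ≮⇒≥; n∸n≡0; *-commutativeSemigroup)
  open import Algebra.Properties.CommutativeSemigroup *-commutativeSemigroup using (x∙yz≈y∙xz)
  open import Data.Fin using (Fin; zero; suc; toℕ; _≟_)
  open import Data.List using (List; _∷_; [_]; map; _++_; allFin; reverse; length; filterᵇ)
  open import Data.List.Properties using (length-map; length-reverse; unfold-reverse; reverse-map; map-cong)
  open import Data.List.Relation.Unary.Unique.Propositional using (Unique)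
  open import Data.List.Relation.Unary.Unique.Propositional.Properties using (allFin⁺)
  open import Data.List.Relation.Binary.Permutation.Propositional using (↭⇒↭ₛ; ↭-sym)
  open import Data.List.Relation.Binary.Permutation.Propositional.Properties using (↭-reverse)
  import Data.List.Relation.Binary.Permutation.Setoid.Properties as Permutation
  open import Function using (_∘_)
  open import Relation.Nullary using (yes; no)
  open import Relation.Binary.PropositionalEquality hiding ([_])

  private variable n : ℕ

  reverse-allFin-unique : ∀ n → Unique (reverse (allFin n))
  reverse-allFin-unique n =
    Permutation.Unique-resp-↭ (setoid (Fin n)) (↭⇒↭ₛ (↭-sym (↭-reverse (allFin n)))) (allFin⁺ n)

  backwardValues : (Fin n → Fin n) → List ℕ
  backwardValues {n} σ = map (toℕ ∘ σ) (reverse (allFin n))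

  length-backwardValues : (σ : Fin n → Fin n) → length (backwardValues σ) ≡ n
  length-backwardValues {n} σ =
    trans (length-map (toℕ ∘ σ) (reverse (allFin n))) (trans (length-reverse (allFin n)) (length-allFin n))

  L-decreasing : ∀ k (σ : Fin n → Fin n) → (k ≤ᵇ L σ) ≡ decreasing k (backwardValues σ)
  L-decreasing {n} k σ =
    trans (decreasing-decPrefixLen k _) (cong (decreasing k) (sym (reverse-map (toℕ ∘ σ) (allFin n))))

  L-cong : {σ τ : Fin n → Fin n} → σ ≗ τ → L σ ≡ L τ
  L-cong {n} σ≗τ = cong (decPrefixLen ∘ reverse) (map-cong (cong toℕ ∘ σ≗τ) (allFin n))

  toℕ-insertAfter-suc : (σ : Fin n → Fin n) (q i : Fin n) →
    toℕ (insertAfter σ q (suc i)) ≡ markMin (toℕ ∘ σ) q i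
  toℕ-insertAfter-suc σ q i with i ≟ q
  ... | yes _ = refl
  ... | no  _ = refl

  -- For k ≤ n the threshold L ≥ k only sees the last n values, so after the
  -- insertion it is read off the marked values of σ.
  L-insertAfter : ∀ k (σ : Fin n → Fin n) q → k ≤ n →
    (k ≤ᵇ L (insertAfter σ q)) ≡ decreasing k (map (markMin (toℕ ∘ σ) q) (reverse (allFin n)))
  L-insertAfter {n} k σ q k≤n = begin
    (k ≤ᵇ L (insertAfter σ q))
      ≡⟨ decreasing-decPrefixLen k _ ⟩
    decreasing k (reverse (map (toℕ ∘ insertAfter σ q) (allFin (suc n))))
      ≡⟨ cong (decreasing k ∘ reverse) (map-allFin-suc (toℕ ∘ insertAfter σ q)) ⟩
    decreasing k (reverse (toℕ (suc (σ q)) ∷ shifted))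
      ≡⟨ cong (decreasing k) (unfold-reverse _ shifted) ⟩
    decreasing k (reverse shifted ++ [ toℕ (suc (σ q)) ])
      ≡⟨ decreasing-++ k (reverse shifted) _ (subst (k ≤_) (sym length-shifted) k≤n) ⟩
    decreasing k (reverse shifted)
      ≡⟨ cong (decreasing k) (reverse-map _ (allFin n)) ⟨
    decreasing k (map (toℕ ∘ insertAfter σ q ∘ suc) (reverse (allFin n)))
      ≡⟨ cong (decreasing k) (map-cong (toℕ-insertAfter-suc σ q) (reverse (allFin n))) ⟩
    decreasing k (map (markMin (toℕ ∘ σ) q) (reverse (allFin n))) ∎
    where
    open ≡-Reasoning
    shifted = map (toℕ ∘ insertAfter σ q ∘ suc) (allFin n)
    length-shifted : length (reverse shifted) ≡ n
    length-shifted = trans (length-reverse shifted) (trans (length-map _ (allFin n)) (length-allFin n))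

  ∑-insertAfter-L : ∀ k (σ : Fin n → Fin n) → suc k ≤ n →
    ∑[ q ← allFin n ] ⟦ suc k ≤ᵇ L (insertAfter σ q) ⟧
      ≡ (n ∸ suc k) * ⟦ suc k ≤ᵇ L σ ⟧ + ⟦ k ≤ᵇ L σ ⟧
  ∑-insertAfter-L {n} k σ k<n = begin
    ∑[ q ← allFin n ] ⟦ suc k ≤ᵇ L (insertAfter σ q) ⟧
      ≡⟨ ∑-cong (allFin n) (λ q → cong ⟦_⟧ (L-insertAfter (suc k) σ q k<n)) ⟩
    ∑[ q ← allFin n ] G (map (markMin v q) ps)
      ≡⟨ ∑-reverse (allFin n) _ ⟨
    ∑[ q ← ps ] G (map (markMin v q) ps)
      ≡⟨ ∑-markMin G v ps (reverse-allFin-unique n) ⟩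
    ∑< (length ps) (λ j → G (withMinAt j zs))
      ≡⟨ cong (λ m → ∑< m (λ j → G (withMinAt j zs))) (length-map v ps) ⟨
    ∑< (length zs) (λ j → G (withMinAt j zs))
      ≡⟨ ∑-withMinAt k zs (subst (suc k ≤_) (sym (length-backwardValues σ)) k<n) ⟩
    (length zs ∸ suc k) * G zs + ⟦ decreasing k zs ⟧
      ≡⟨ cong₂ _+_ (cong₂ _*_ (cong (_∸ suc k) (length-backwardValues σ))
                              (cong ⟦_⟧ (sym (L-decreasing (suc k) σ))))
                   (cong ⟦_⟧ (sym (L-decreasing k σ))) ⟩
    (n ∸ suc k) * ⟦ suc k ≤ᵇ L σ ⟧ + ⟦ k ≤ᵇ L σ ⟧ ∎
    where
    open ≡-Reasoning
    G : List ℕ → ℕ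
    G = ⟦_⟧ ∘ decreasing (suc k)
    v = toℕ ∘ σ
    ps = reverse (allFin n)
    zs = backwardValues σ

  cyclesWithL : ℕ → ℕ → ℕ
  cyclesWithL b k = ∑[ σ ← fullCycles b ] ⟦ k ≤ᵇ L σ ⟧

  cyclesWithL-suc : ∀ n k → suc k ≤ suc n →
    cyclesWithL (suc (suc n)) (suc k) ≡ (n ∸ k) * cyclesWithL (suc n) (suc k) + cyclesWithL (suc n) k
  cyclesWithL-suc n k k<n+1 = begin
    cyclesWithL (suc (suc n)) (suc k)
      ≡⟨ ∑-fullCycles-suc {n} (λ σ → ⟦ suc k ≤ᵇ L σ ⟧) (cong (λ l → ⟦ suc k ≤ᵇ l ⟧) ∘ L-cong) ⟩
    ∑[ σ ← fullCycles (suc n) ] ∑[ q ← allFin (suc n) ] ⟦ suc k ≤ᵇ L (insertAfter σ q) ⟧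
      ≡⟨ ∑-cong (fullCycles (suc n)) (λ σ → ∑-insertAfter-L k σ k<n+1) ⟩
    ∑[ σ ← fullCycles (suc n) ] ((n ∸ k) * ⟦ suc k ≤ᵇ L σ ⟧ + ⟦ k ≤ᵇ L σ ⟧)
      ≡⟨ ∑-+ (fullCycles (suc n)) _ _ ⟩
    ∑[ σ ← fullCycles (suc n) ] ((n ∸ k) * ⟦ suc k ≤ᵇ L σ ⟧) + cyclesWithL (suc n) k
      ≡⟨ cong (_+ cyclesWithL (suc n) k) (∑-*ˡ (fullCycles (suc n)) (n ∸ k) _) ⟩
    (n ∸ k) * cyclesWithL (suc n) (suc k) + cyclesWithL (suc n) k ∎
    where open ≡-Reasoning

  cyclesWithL-zero : ∀ n → cyclesWithL (suc (suc n)) 0 ≡ suc n * cyclesWithL (suc n) 0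
  cyclesWithL-zero n = begin
    cyclesWithL (suc (suc n)) 0
      ≡⟨ ∑-fullCycles-suc {n} (λ _ → 1) (λ _ → refl) ⟩
    ∑[ σ ← fullCycles (suc n) ] ∑[ q ← allFin (suc n) ] 1
      ≡⟨ ∑-cong (fullCycles (suc n)) (λ σ → trans (∑-const (allFin (suc n)) 1)
                                                  (cong (_* 1) (length-allFin (suc n)))) ⟩
    ∑[ σ ← fullCycles (suc n) ] (suc n * 1)
      ≡⟨ ∑-*ˡ (fullCycles (suc n)) (suc n) (λ _ → 1) ⟩
    suc n * cyclesWithL (suc n) 0 ∎
    where open ≡-Reasoning

  factorial-cyclesWithL : ∀ n k → k ≤ n → k ! * cyclesWithL (suc n) k ≡ cyclesWithL (suc n) 0
  factorial-cyclesWithL n       zero    _         = +-identityʳ _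
  factorial-cyclesWithL (suc n) (suc k) (s≤s k≤n) = begin
    suc k ! * cyclesWithL (suc (suc n)) (suc k)
      ≡⟨ cong (suc k ! *_) (cyclesWithL-suc n k (s≤s k≤n)) ⟩
    suc k ! * ((n ∸ k) * C (suc k) + C k)
      ≡⟨ *-distribˡ-+ (suc k !) _ _ ⟩
    suc k ! * ((n ∸ k) * C (suc k)) + suc k * k ! * C k
      ≡⟨ cong₂ _+_ (x∙yz≈y∙xz (suc k !) (n ∸ k) _) (*-assoc (suc k) (k !) _) ⟩
    (n ∸ k) * (suc k ! * C (suc k)) + suc k * (k ! * C k)
      ≡⟨ cong₂ _+_ surviving (cong (suc k *_) (factorial-cyclesWithL n k k≤n)) ⟩
    (n ∸ k) * T + suc k * T
      ≡⟨ *-distribʳ-+ T (n ∸ k) (suc k) ⟨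
    (n ∸ k + suc k) * T
      ≡⟨ cong (_* T) (trans (+-suc (n ∸ k) k) (cong suc (m∸n+n≡m k≤n))) ⟩
    suc n * T
      ≡⟨ cyclesWithL-zero n ⟨
    cyclesWithL (suc (suc n)) 0 ∎
    where
    open ≡-Reasoning
    C = cyclesWithL (suc n)
    T = C 0
    -- the induction hypothesis at k + 1 is only needed when k < n; otherwise n ∸ k = 0
    surviving : (n ∸ k) * (suc k ! * C (suc k)) ≡ (n ∸ k) * T
    surviving with suc k ≤? n
    ... | yes k<n = cong ((n ∸ k) *_) (factorial-cyclesWithL n (suc k) k<n)
    ... | no  k≮n rewrite ≤-antisym k≤n (≮⇒≥ k≮n) | n∸n≡0 n = refl

open FiniteSums using (∑-const; length-filterᵇ)
open LastRun using (cyclesWithL; factorial-cyclesWithL)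

-- The theorem.
lemma6p3 : (b k : ℕ) → 2 ≤ b → 1 ≤ k → k ≤ b ∸ 1 →
    (k !) * length (filterᵇ (λ σ → k ≤ᵇ L σ) (fullCycles b)) ≡ length (fullCycles b)
lemma6p3 (suc (suc n)) k (s≤s (s≤s _)) _ k≤n+1 = begin
  k ! * length (filterᵇ (λ σ → k ≤ᵇ L σ) (fullCycles b))
    ≡⟨ cong (k ! *_) (length-filterᵇ (λ σ → k ≤ᵇ L σ) (fullCycles b)) ⟩
  k ! * cyclesWithL b k
    ≡⟨ factorial-cyclesWithL (suc n) k k≤n+1 ⟩
  cyclesWithL b 0
    ≡⟨ ∑-const (fullCycles b) 1 ⟩
  length (fullCycles b) * 1
    ≡⟨ *-identityʳ _ ⟩
  length (fullCycles b) ∎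
  where
  open ≡-Reasoning
  b = suc (suc n)
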